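{- Let $(\longmapsto_i)_{i\in\mathbf{N}}$ be a chain of concrete behaviors and let $sat$ be an abstract behavior. If $sat$ safely approximates $\longmapsto_i$ for all $i\in\mathbf{N}$, then $sat$ safely approximates $\sqcup_{i=0}^{\infty}\longmapsto_i$.
   Context: Fix a normalized Prolog program $P$ (pure Prolog with cut). Program substitution sequences (finite, incomplete i.e. ending with $\bot$, or infinite) are ordered by $S_1\sqsubseteq S_2$ iff $S_1=S_2$ or $S_1=S::<\bot>$ and $S_2=S::S'$ with $S$ finite. A concrete behavior $\longmapsto$ is a total function mapping each pair $\langle \theta,p\rangle$ ($p$ a procedure name of $P$ of arity $n$, $\theta$ a canonical program substitution over $\{x_1,\dots,x_n\}$) to a canonical program substitution sequence; concrete behaviors form a pointed cpo under the pointwise ordering, the least upper bound of a chain being computed pointwise. Abstract sequences have monotone concretization functions $Cc$ such that each $Cc(B)$ is chain-closed: it contains the limit of every $\sqsubseteq$-increasing chain of its elements. An abstract behavior $sat$ maps each $\langle\beta,p\rangle$ ($\beta$ an abstract substitution over $\{x_1,\dots,x_n\}$) to an abstract sequence. $sat$ safely approximates a concrete behavior $\longmapsto$ iff for all $\langle\theta,p\rangle$, $\langle\beta,p\rangle$: $\theta\in Cc(\beta)$ and $\langle\theta,p\rangle\longmapsto S$ imply $S\in Cc(sat\langle\beta,p\rangle)$. -}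

module Defs where

open import Data.Nat using (ℕ; zero; suc)
open import Data.List using (List; []; _∷_)
open import Data.Product using (Σ; _×_; _,_)
open import Data.Sum using (_⊎_)
open import Relation.Binary.PropositionalEquality using (_≡_)

-- Program substitution sequences over a type A of program substitutions:
-- finite  <θ1,...,θk>, incomplete <θ1,...,θk,⊥>, or infinite <θ1,θ2,...>.

data Seq (A : Set) : Set where
  fin : List A → Seq A
  inc : List A → Seq A
  inf : (ℕ → A) → Seq A

data _PrefixOf_ {A : Set} : List A → Seq A → Set where
  nil-fin  : ∀ {m} → [] PrefixOf fin m
  nil-inc  : ∀ {m} → [] PrefixOf inc m
  nil-inf  : ∀ {f} → [] PrefixOf inf f
  cons-fin : ∀ {x l m} → l PrefixOf fin m → (x ∷ l) PrefixOf fin (x ∷ m)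
  cons-inc : ∀ {x l m} → l PrefixOf inc m → (x ∷ l) PrefixOf inc (x ∷ m)
  cons-inf : ∀ {x l f} → f 0 ≡ x → l PrefixOf inf (λ n → f (suc n))
           → (x ∷ l) PrefixOf inf f

data _≈S_ {A : Set} : Seq A → Seq A → Set where
  fin≈ : ∀ {l} → fin l ≈S fin l
  inc≈ : ∀ {l} → inc l ≈S inc l
  inf≈ : ∀ {f g} → (∀ n → f n ≡ g n) → inf f ≈S inf g

data _⊑_ {A : Set} : Seq A → Seq A → Set where
  ⊑-eq  : ∀ {S₁ S₂} → S₁ ≈S S₂ → S₁ ⊑ S₂
  ⊑-ext : ∀ {l S₂} → l PrefixOf S₂ → inc l ⊑ S₂

IsChain : ∀ {A : Set} → (ℕ → Seq A) → Set
IsChain c = ∀ i → c i ⊑ c (suc i)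

IsLub : ∀ {A : Set} → Seq A → (ℕ → Seq A) → Set
IsLub L c = (∀ i → c i ⊑ L) × (∀ U → (∀ i → c i ⊑ U) → L ⊑ U)

ChainClosed : ∀ {A : Set} → (Seq A → Set) → Set
ChainClosed {A} C =
  ∀ (c : ℕ → Seq A) → IsChain c → (∀ i → C (c i)) → ∀ L → IsLub L c → C L

record Setting : Set₁ where
  field
    Proc     : Set
    arity    : Proc → ℕ
    Subst    : ℕ → Set                     -- canonical program substs over {x1..xn}
    AbsSubst : ℕ → Set                     -- abstract substitutions over {x1..xn}
    AbsSeq   : ℕ → Set
    CcSubst  : ∀ {n} → AbsSubst n → Subst n → Set
    _≤ₐ_     : ∀ {n} → AbsSeq n → AbsSeq n → Set
    Cc       : ∀ {n} → AbsSeq n → Seq (Subst n) → Set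
    Cc-mono  : ∀ {n} {B B' : AbsSeq n} → B ≤ₐ B' → ∀ S → Cc B S → Cc B' S
    Cc-closed : ∀ {n} (B : AbsSeq n) → ChainClosed (Cc B)

module _ (𝒮 : Setting) where
  open Setting 𝒮

  ConcreteBehavior : Set
  ConcreteBehavior = (p : Proc) → Subst (arity p) → Seq (Subst (arity p))

  AbstractBehavior : Set
  AbstractBehavior = (p : Proc) → AbsSubst (arity p) → AbsSeq (arity p)

  _⊑B_ : ConcreteBehavior → ConcreteBehavior → Set
  B₁ ⊑B B₂ = ∀ p θ → B₁ p θ ⊑ B₂ p θ

  IsBehaviorChain : (ℕ → ConcreteBehavior) → Set
  IsBehaviorChain B = ∀ i → B i ⊑B B (suc i)

  IsBehaviorLub : ConcreteBehavior → (ℕ → ConcreteBehavior) → Set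
  IsBehaviorLub L B = ∀ p θ → IsLub (L p θ) (λ i → B i p θ)

  SafelyApproximates : AbstractBehavior → ConcreteBehavior → Set
  SafelyApproximates sat B =
    ∀ p (θ : Subst (arity p)) (β : AbsSubst (arity p)) →
      CcSubst β θ → Cc (sat p β) (B p θ)

-- Safety of a behavior is a conjunction, over all ⟨θ,p⟩ and ⟨β,p⟩ with θ ∈ Cc β,
-- of the membership B⟨θ,p⟩ ∈ Cc(sat⟨β,p⟩). Since the lub of behaviors is taken
-- pointwise, each such membership for the lub is the limit of the chain of
-- memberships for the Bᵢ, and holds because Cc(sat⟨β,p⟩) is chain-closed.
module Submission where

open import Defs
open import Data.Nat using (ℕ)

mainTheorem9 : (𝒮 : Setting) (B : ℕ → ConcreteBehavior 𝒮) (sat : AbstractBehavior 𝒮)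
    → IsBehaviorChain 𝒮 B
    → (∀ i → SafelyApproximates 𝒮 sat (B i))
    → (L : ConcreteBehavior 𝒮) → IsBehaviorLub 𝒮 L B
    → SafelyApproximates 𝒮 sat L
mainTheorem9 𝒮 B sat chain safe L lub p θ β θ∈β =
  Cc-closed (sat p β) (λ i → B i p θ) (λ i → chain i p θ)
    (λ i → safe i p θ β θ∈β) (L p θ) (lub p θ)
  where open Setting 𝒮
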